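{- Let $\mathcal{R}$ be an RBox and let $M=\langle \Delta,\mathcal{C},\mathcal{E}\rangle$ be a consistent $\mathcal{R}$-saturated model graph, and let $\mathcal{I}$ be the $\mathcal{R}$-model corresponding to $M$. Then $\mathcal{I}$ is a model of $\mathcal{R}$ and, for every $x\in\Delta$ and every concept $C\in\mathcal{C}(x)$, we have $x\in C^\mathcal{I}$.
   Context: Roles, concepts ($\top,\bot,A,\neg C, C\sqcap D, C\sqcup D,\forall R.C,\exists R.C$), RBoxes (finite sets of axioms $R\sqsubseteq S$, $R\circ R\sqsubseteq R$), interpretations and models of an RBox are as in the description logic $\mathcal{SHI}$ (with $(r^-)^- = r$ and $(r^-)^\mathcal{I}$ the converse of $r^\mathcal{I}$). All concepts are assumed to be in negation normal form (negation occurs only directly before concept names). $\mathrm{Ext}(\mathcal{R})$ is the least extension of $\mathcal{R}$ such that: $R\sqsubseteq R\in\mathrm{Ext}(\mathcal{R})$ for every role $R$; if $R\sqsubseteq S\in\mathrm{Ext}(\mathcal{R})$ then $R^-\sqsubseteq S^-\in\mathrm{Ext}(\mathcal{R})$; if $R\circ R\sqsubseteq R\in\mathrm{Ext}(\mathcal{R})$ then $R^-\circ R^-\sqsubseteq R^-\in\mathrm{Ext}(\mathcal{R})$; if $R\sqsubseteq S$ and $S\sqsubseteq T$ are in $\mathrm{Ext}(\mathcal{R})$ then $R\sqsubseteq T\in\mathrm{Ext}(\mathcal{R})$. Write $R\sqsubseteq_\mathcal{R} S$ iff $R\sqsubseteq S\in\mathrm{Ext}(\mathcal{R})$. For a set $X$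 of concepts and a role $R$, $\mathrm{Trans}_\mathcal{R}(X,R)=\{D\mid \forall R.D\in X\}\cup\{\forall S.D\in X\mid R\sqsubseteq_\mathcal{R} S \text{ and } S\circ S\sqsubseteq S\in\mathrm{Ext}(\mathcal{R})\}$. A model graph is a tuple $\langle\Delta,\mathcal{C},\mathcal{E}\rangle$ where $\Delta$ is a finite set containing all individual names, $\mathcal{C}$ maps each element of $\Delta$ to a set of concepts, and $\mathcal{E}$ maps each role to a binary relation on $\Delta$. It is $\mathcal{R}$-saturated if for every $x\in\Delta$: (1) $C\sqcap D\in\mathcal{C}(x)$ implies $\{C,D\}\subseteq\mathcal{C}(x)$; (2) $C\sqcup D\in\mathcal{C}(x)$ implies $C\in\mathcal{C}(x)$ or $D\in\mathcal{C}(x)$; (3) $\forall S.C\in\mathcal{C}(x)$ and $R\sqsubseteq_\mathcal{R} S$ imply $\forall R.C\in\mathcal{C}(x)$; (4) $(x,y)\in\mathcal{E}(R)$ implies $\mathrm{Trans}_\mathcal{R}(\mathcal{C}(x),R)\subseteq\mathcal{C}(y)$; (5) $(x,y)\in\mathcal{E}(R)$ implies $\mathrm{Trans}_\mathcal{R}(\mathcal{C}(y),R^-)\subseteq\mathcal{C}(x)$; (6) $\exists R.C\in\mathcal{C}(x)$ implies there is $y\in\Delta$ with $(x,y)\in\mathcal{E}(R)$ and $C\in\mathcal{C}(y)$. It is consistent if no $\mathcal{C}(x)$ contains $\bot$ or contains both $A$ and $\neg A$ for a concept name $A$. The $\mathcal{R}$-model corresponding to $M$ is the interpretation $\mathcal{I}$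 with domain $\Delta$, $a^\mathcal{I}=a$ for individual names $a$, $A^\mathcal{I}=\{x\in\Delta\mid A\in\mathcal{C}(x)\}$ for concept names $A$, and $r^\mathcal{I}=\mathcal{E}'(r)$ for role names $r$, where $(\mathcal{E}'(R))_R$ ($R$ ranging over roles) are the smallest binary relations on $\Delta$ such that $\mathcal{E}(R)\subseteq\mathcal{E}'(R)$, $\mathcal{E}'(R^-)=(\mathcal{E}'(R))^{ -1}$, $\mathcal{E}'(R)\subseteq\mathcal{E}'(S)$ whenever $R\sqsubseteq_\mathcal{R}S$, and $\mathcal{E}'(R)\circ\mathcal{E}'(R)\subseteq\mathcal{E}'(R)$ whenever $R\circ R\sqsubseteq R\in\mathrm{Ext}(\mathcal{R})$. -}

module Defs where

open import Data.Nat using (ℕ)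
open import Data.Fin using (Fin)
open import Data.List using (List)
open import Data.List.Membership.Propositional using (_∈_)
open import Data.Product using (Σ; _×_; _,_)
open import Data.Sum using (_⊎_)
open import Data.Empty using (⊥)
open import Relation.Nullary using (¬_)
open import Relation.Binary.PropositionalEquality using (_≡_)
open import Function.Definitions using (Injective)

module SHI (RN CN IN : Set) where

  data Role : Set where
    rn  : RN → Role
    inv : RN → Role

  _⁻ : Role → Role
  rn r ⁻  = inv r
  inv r ⁻ = rn r

  -- Concepts in negation normal form (negation only on concept names)
  data Concept : Set where
    ⊤c ⊥c : Concept
    atom  : CN → Concept
    neg   : CN → Concept
    _⊓_ _⊔_ : Concept → Concept → Concept
    all ex  : Role → Concept → Concept

  data Axiom : Set where
    _⊑_  : Role → Role → Axiom
    tra  : Role → Axiom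

  RBox : Set
  RBox = List Axiom

  data Ext (ℛ : RBox) : Axiom → Set where
    ax      : ∀ {a} → a ∈ ℛ → Ext ℛ a
    ⊑-refl  : ∀ R → Ext ℛ (R ⊑ R)
    ⊑-inv   : ∀ {R S} → Ext ℛ (R ⊑ S) → Ext ℛ ((R ⁻) ⊑ (S ⁻))
    tra-inv : ∀ {R} → Ext ℛ (tra R) → Ext ℛ (tra (R ⁻))
    ⊑-trans : ∀ {R S T} → Ext ℛ (R ⊑ S) → Ext ℛ (S ⊑ T) → Ext ℛ (R ⊑ T)

  _⊑[_]_ : Role → RBox → Role → Set
  R ⊑[ ℛ ] S = Ext ℛ (R ⊑ S)

  CSet : Set₁
  CSet = Concept → Set

  Trans : RBox → CSet → Role → CSet
  Trans ℛ X R D =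
    X (all R D)
    ⊎ Σ Role (λ S → Σ Concept (λ D′ →
        (D ≡ all S D′) × X (all S D′) × (R ⊑[ ℛ ] S) × Ext ℛ (tra S)))

  -- Model graphs: Δ = Fin n (a finite set), individual names injected into Δ
  record ModelGraph : Set₁ where
    field
      n    : ℕ
      ind  : IN → Fin n
      ind-inj : Injective _≡_ _≡_ ind
      𝒞    : Fin n → CSet
      ℰ    : Role → Fin n → Fin n → Set

  module _ (ℛ : RBox) (M : ModelGraph) where
    open ModelGraph M

    record Saturated : Set where
      field
        sat-⊓ : ∀ x C D → 𝒞 x (C ⊓ D) → 𝒞 x C × 𝒞 x D
        sat-⊔ : ∀ x C D → 𝒞 x (C ⊔ D) → 𝒞 x C ⊎ 𝒞 x D
        sat-∀ : ∀ x S C R → 𝒞 x (all S C) → R ⊑[ ℛ ] S → 𝒞 x (all R C)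
        sat-fw : ∀ x y R → ℰ R x y → ∀ D → Trans ℛ (𝒞 x) R D → 𝒞 y D
        sat-bw : ∀ x y R → ℰ R x y → ∀ D → Trans ℛ (𝒞 y) (R ⁻) D → 𝒞 x D
        sat-∃ : ∀ x R C → 𝒞 x (ex R C) →
                Σ (Fin n) (λ y → ℰ R x y × 𝒞 y C)

    Consistent : Set
    Consistent = ∀ x → ¬ 𝒞 x ⊥c × (∀ A → ¬ (𝒞 x (atom A) × 𝒞 x (neg A)))

    data ℰ′ : Role → Fin n → Fin n → Set where
      base : ∀ {R x y} → ℰ R x y → ℰ′ R x y
      conv : ∀ {R x y} → ℰ′ R x y → ℰ′ (R ⁻) y x
      sub  : ∀ {R S x y} → R ⊑[ ℛ ] S → ℰ′ R x y → ℰ′ S x y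
      comp : ∀ {R x y z} → Ext ℛ (tra R) → ℰ′ R x y → ℰ′ R y z → ℰ′ R x z

  record Interpretation (n : ℕ) : Set₁ where
    field
      indI  : IN → Fin n
      concI : CN → Fin n → Set
      roleI : RN → Fin n → Fin n → Set

  module _ {n : ℕ} (I : Interpretation n) where
    open Interpretation I

    ⟦_⟧R : Role → Fin n → Fin n → Set
    ⟦ rn r ⟧R x y  = roleI r x y
    ⟦ inv r ⟧R x y = roleI r y x

    ⟦_⟧ : Concept → Fin n → Set
    ⟦ ⊤c ⟧ x = Data.Unit.⊤ where import Data.Unit
    ⟦ ⊥c ⟧ x = ⊥
    ⟦ atom A ⟧ x = concI A x
    ⟦ neg A ⟧ x = ¬ concI A x
    ⟦ C ⊓ D ⟧ x = ⟦ C ⟧ x × ⟦ D ⟧ x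
    ⟦ C ⊔ D ⟧ x = ⟦ C ⟧ x ⊎ ⟦ D ⟧ x
    ⟦ all R C ⟧ x = ∀ y → ⟦ R ⟧R x y → ⟦ C ⟧ y
    ⟦ ex R C ⟧ x = Σ (Fin n) (λ y → ⟦ R ⟧R x y × ⟦ C ⟧ y)

    ⊨ax : Axiom → Set
    ⊨ax (R ⊑ S) = ∀ x y → ⟦ R ⟧R x y → ⟦ S ⟧R x y
    ⊨ax (tra R) = ∀ x y z → ⟦ R ⟧R x y → ⟦ R ⟧R y z → ⟦ R ⟧R x z

    _⊨_ : RBox → Set
    _⊨_ ℛ = ∀ a → a ∈ ℛ → ⊨ax a

  corrModel : (ℛ : RBox) (M : ModelGraph) → Interpretation (ModelGraph.n M)
  corrModel ℛ M = record
    { indI  = ModelGraph.ind M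
    ; concI = λ A x → ModelGraph.𝒞 M x (atom A)
    ; roleI = λ r → ℰ′ ℛ M (rn r)
    }

module Submission where

-- Roles of I are
-- interpreted by the closure E' of the edges of M, so I satisfies every RBox
-- axiom by construction.
--
-- The truth lemma (C ∈ 𝒞(x) implies x ∈ C^I) goes by induction on C.  The
-- only nontrivial case is ∀R.C: an R-edge of I is an E'-edge, not necessarily
-- an edge of M.  We therefore introduce the invariant "R-propagation from x to
-- y": whenever R ⊑ S and ∀S.D ∈ 𝒞(x), then D ∈ 𝒞(y), and also ∀S.D ∈ 𝒞(y)
-- when S is transitive.  Saturation gives it (in both directions) for edges
-- of M, and it is preserved by role inclusion, by composition along
-- transitive roles and by taking inverses; so it holds along every E'-edge.

open import Defs
open import Data.Product using (_×_; _,_; proj₁; proj₂)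
open import Data.Fin using (Fin)
open import Data.Sum using (inj₁; inj₂)
open import Data.Unit using (tt)
open import Relation.Binary.PropositionalEquality using (refl)

module Soundness (RN CN IN : Set) where
  open SHI RN CN IN

  module _ (ℛ : RBox) (M : ModelGraph) where
    open ModelGraph M

    I : Interpretation n
    I = corrModel ℛ M

    ⟦⟧R⇒ℰ′ : ∀ R {x y} → ⟦ I ⟧R R x y → ℰ′ ℛ M R x y
    ⟦⟧R⇒ℰ′ (rn r)  e = e
    ⟦⟧R⇒ℰ′ (inv r) e = conv e

    ℰ′⇒⟦⟧R : ∀ R {x y} → ℰ′ ℛ M R x y → ⟦ I ⟧R R x y
    ℰ′⇒⟦⟧R (rn r)  e = e
    ℰ′⇒⟦⟧R (inv r) e = conv e

    corrModel-⊨ : I ⊨ ℛ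
    corrModel-⊨ (R ⊑ S) R⊑S∈ℛ x y e =
      ℰ′⇒⟦⟧R S (sub (ax R⊑S∈ℛ) (⟦⟧R⇒ℰ′ R e))
    corrModel-⊨ (tra R) traR∈ℛ x y z e f =
      ℰ′⇒⟦⟧R R (comp (ax traR∈ℛ) (⟦⟧R⇒ℰ′ R e) (⟦⟧R⇒ℰ′ R f))

    Propagates : Role → Fin n → Fin n → Set
    Propagates R x y =
      ∀ S D → R ⊑[ ℛ ] S → 𝒞 x (all S D) →
      𝒞 y D × (Ext ℛ (tra S) → 𝒞 y (all S D))

    propagates-sub : ∀ {R R′ x y} → R ⊑[ ℛ ] R′ →
                     Propagates R x y → Propagates R′ x y
    propagates-sub R⊑R′ p S D R′⊑S = p S D (⊑-trans R⊑R′ R′⊑S)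

    propagates-⁻⁻ : ∀ R {x y} → Propagates R x y → Propagates ((R ⁻) ⁻) x y
    propagates-⁻⁻ (rn r)  p = p
    propagates-⁻⁻ (inv r) p = p

    module _ (sat : Saturated ℛ M) where
      open Saturated sat

      -- For a transitive R, propagation composes: ∀S.D at x yields ∀R.D at
      -- x (rule 3), which travels through y to z; and transitive S pass on
      -- ∀S.D themselves.
      propagates-comp : ∀ {R x y z} → Ext ℛ (tra R) →
                        Propagates R x y → Propagates R y z → Propagates R x z
      propagates-comp {R} {x} {y} {z} traR p q S D R⊑S ∀SD =
        proj₁ (q R D (⊑-refl R) ∀RD-at-y) , ∀SD-at-z
        where
          ∀RD-at-y : 𝒞 y (all R D)
          ∀RD-at-y = proj₂ (p R D (⊑-refl R) (sat-∀ x S D R ∀SD R⊑S)) traR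
          ∀SD-at-z : Ext ℛ (tra S) → 𝒞 z (all S D)
          ∀SD-at-z = λ traS → proj₂ (q S D R⊑S (proj₂ (p S D R⊑S ∀SD) traS)) traS

      edge-propagates : ∀ {R x y} → ℰ R x y →
                        Propagates R x y × Propagates (R ⁻) y x
      edge-propagates {R} {x} {y} e =
        (λ S D R⊑S ∀SD →
           sat-fw x y R e D (inj₁ (sat-∀ x S D R ∀SD R⊑S))
         , λ traS → sat-fw x y R e (all S D) (inj₂ (S , D , refl , ∀SD , R⊑S , traS)))
        , (λ S D R⁻⊑S ∀SD →
           sat-bw x y R e D (inj₁ (sat-∀ y S D (R ⁻) ∀SD R⁻⊑S))
         , λ traS → sat-bw x y R e (all S D) (inj₂ (S , D , refl , ∀SD , R⁻⊑S , traS)))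

      ℰ′-propagates : ∀ {R x y} → ℰ′ ℛ M R x y →
                      Propagates R x y × Propagates (R ⁻) y x
      ℰ′-propagates (base e) = edge-propagates e
      ℰ′-propagates (conv {R} e) with ℰ′-propagates e
      ... | fw , bw = bw , propagates-⁻⁻ R fw
      ℰ′-propagates (sub R⊑S e) with ℰ′-propagates e
      ... | fw , bw = propagates-sub R⊑S fw , propagates-sub (⊑-inv R⊑S) bw
      ℰ′-propagates (comp traR e f) with ℰ′-propagates e | ℰ′-propagates f
      ... | fw , bw | fw′ , bw′ =
        propagates-comp traR fw fw′ , propagates-comp (tra-inv traR) bw′ bw

      truth : Consistent ℛ M → ∀ C x → 𝒞 x C → ⟦ I ⟧ C x
      truth con ⊤c       x c = tt
      truth con ⊥c       x c = proj₁ (con x) c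
      truth con (atom A) x c = c
      truth con (neg A)  x c a = proj₂ (con x) A (a , c)
      truth con (C ⊓ D)  x c with sat-⊓ x C D c
      ... | c₁ , c₂ = truth con C x c₁ , truth con D x c₂
      truth con (C ⊔ D)  x c with sat-⊔ x C D c
      ... | inj₁ c₁ = inj₁ (truth con C x c₁)
      ... | inj₂ c₂ = inj₂ (truth con D x c₂)
      truth con (all R C) x c y e =
        truth con C y (proj₁ (proj₁ (ℰ′-propagates (⟦⟧R⇒ℰ′ R e)) R C (⊑-refl R) c))
      truth con (ex R C) x c with sat-∃ x R C c
      ... | y , e , c′ = y , ℰ′⇒⟦⟧R R (base e) , truth con C y c′

mainTheorem2 : (RN CN IN : Set) → let open SHI RN CN IN in
    (ℛ : RBox) (M : ModelGraph) →
    Consistent ℛ M → Saturated ℛ M →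
    (corrModel ℛ M ⊨ ℛ) ×
    (∀ (x : Fin (ModelGraph.n M)) (C : Concept) → ModelGraph.𝒞 M x C → ⟦ corrModel ℛ M ⟧ C x)
mainTheorem2 RN CN IN ℛ M con sat =
  corrModel-⊨ ℛ M , λ x C c → truth ℛ M sat con C x c
  where open Soundness RN CN IN
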